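{- Let $m\in\{3,4,5\}$. For all $\varphi,\psi\in Fm(C)$: $\vdash_m(\varphi\equiv\psi)\rightarrow\square(\varphi\equiv\psi)$.
   Context: Let $V=\{x_0,x_1,x_2,\dots\}$ be a countable, linearly ordered set of propositional variables and $C$ a set of propositional constants with $\top,\bot\in C$. $Fm(C)$ is the set of formulas generated from $V\cup C$ by the unary connectives $\neg,\square$, the binary connectives $\rightarrow,\vee,\wedge,\equiv$ (propositional identity), and the propositional quantifier $\forall$, where $\forall x\varphi$ is a formula only if $x\in V$ occurs free in $\varphi$; $fvar(\varphi)$ is the set of free variables. A substitution $\sigma\colon V\cup C\to Fm(C)$ extends homomorphically over connectives, and $(\forall x\varphi)[\sigma]=\forall y(\varphi[\sigma[x:=y]])$, where $y$ is the least variable greater than all variables free in some $\sigma(u)$ with $u$ a free variable or constant of $\forall x\varphi$. $\varphi[x:=\psi]$ substitutes $\psi$ for $x$. $\varphi=_\alpha\psi$ means $\varphi,\psi$ differ at most in bound variables. The axiom set $\mathbb{AX}$ is the smallest set containing all formulas of the following forms and closed under: if $\varphi\in\mathbb{AX}$ and $x\in fvar(\varphi)$ then $\forall x\varphi\in\mathbb{AX}$: (i) substitution instances of classical propositional tautologies; (ii) $\square\varphi\rightarrow\varphi$; (iii) $\square(\varphi\rightarrow\psi)\rightarrow(\square\varphi\rightarrow\square\psi)$; (iv) $\square(\varphi\rightarrow\psi)\rightarrow\square(\square\varphi\rightarrow\square\psi)$; (v) $\varphi\equiv\psi$ whenever $\varphi=_\alpha\psi$; (vi) $(\varphi\equiv\psi)\rightarrow(\varphi\rightarrow\psi)$;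 (vii) $(\psi\equiv\psi')\rightarrow(\varphi[x:=\psi]\equiv\varphi[x:=\psi'])$ if $x\in fvar(\varphi)$; (viii) $\forall x(\varphi\equiv\psi)\rightarrow(\forall x\varphi\equiv\forall x\psi)$; (ix) $\forall x\varphi\rightarrow\varphi[x:=\psi]$; (x) $\forall x(\varphi\rightarrow\psi)\rightarrow(\forall x\varphi\rightarrow\forall x\psi)$; (xi) $\forall x(\varphi\rightarrow\psi)\rightarrow(\varphi\rightarrow\forall x\psi)$ if $x\notin fvar(\varphi)$; (xii) $\square\forall x\varphi\rightarrow\forall x\square\varphi$; (xiii) $\forall x\square\varphi\rightarrow\square\forall x\varphi$. Rules: Modus Ponens, and Axiom Necessitation (from an axiom $\varphi$ infer $\square\varphi$). $\vdash_3$ denotes derivability (system $S3^\forall_\equiv$); $\vdash_4$ with the scheme $\square\varphi\rightarrow\square\square\varphi$ added to the axioms; $\vdash_5$ with additionally $\neg\square\varphi\rightarrow\square\neg\square\varphi$. -}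

module Defs where

open import Data.Nat using (ℕ; zero; suc; _⊔_)
open import Data.Nat.Properties using (_≟_)
open import Data.Bool using (Bool; true; false; not; _∧_; _∨_; if_then_else_)
open import Data.List using (List; []; _∷_; _++_; foldr)
open import Data.List.Membership.Propositional using (_∈_; _∉_)
open import Data.Product using (_×_)
open import Data.Unit using (⊤)
open import Data.Empty using (⊥)
open import Relation.Nullary using (yes; no)
open import Relation.Binary.PropositionalEquality using (_≡_)

-- Variables x_i are natural numbers i (order = order on ℕ).
-- The constant set C is  {⊤,⊥} ∪ C'  where C' is an arbitrary type
-- (the constructors 'tt', 'ff' are ⊤ and ⊥; 'con c' are the other constants).
-- Raw formulas; the side condition on ∀ is imposed by WF below.

infixr 4 _⇒_
infixr 5 _∨'_
infixr 6 _∧'_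
infix 7 _≡≡_
infix 8 ~_ □_

data Fm (C : Set) : Set where
  var  : ℕ → Fm C
  tt   : Fm C
  ff   : Fm C
  con  : C → Fm C
  ~_   : Fm C → Fm C
  □_   : Fm C → Fm C
  _⇒_  : Fm C → Fm C → Fm C
  _∨'_ : Fm C → Fm C → Fm C
  _∧'_ : Fm C → Fm C → Fm C
  _≡≡_ : Fm C → Fm C → Fm C
  ∀'   : ℕ → Fm C → Fm C

module _ {C : Set} where

  remove : ℕ → List ℕ → List ℕ
  remove x [] = []
  remove x (y ∷ ys) with x ≟ y
  ... | yes _ = remove x ys
  ... | no _  = y ∷ remove x ys

  fv : Fm C → List ℕ
  fv (var x)   = x ∷ []
  fv tt        = []
  fv ff        = []
  fv (con c)   = []
  fv (~ φ)     = fv φ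
  fv (□ φ)     = fv φ
  fv (φ ⇒ ψ)   = fv φ ++ fv ψ
  fv (φ ∨' ψ)  = fv φ ++ fv ψ
  fv (φ ∧' ψ)  = fv φ ++ fv ψ
  fv (φ ≡≡ ψ)  = fv φ ++ fv ψ
  fv (∀' x φ)  = remove x (fv φ)

  WF : Fm C → Set
  WF (var x)   = ⊤
  WF tt        = ⊤
  WF ff        = ⊤
  WF (con c)   = ⊤
  WF (~ φ)     = WF φ
  WF (□ φ)     = WF φ
  WF (φ ⇒ ψ)   = WF φ × WF ψ
  WF (φ ∨' ψ)  = WF φ × WF ψ
  WF (φ ∧' ψ)  = WF φ × WF ψ
  WF (φ ≡≡ ψ)  = WF φ × WF ψ
  WF (∀' x φ)  = (x ∈ fv φ) × WF φ

  -- Substitutions (on variables; constants are mapped to themselves,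
  -- which is all that φ[x:=ψ] needs).

  Sub : Set
  Sub = ℕ → Fm C

  upd : Sub → ℕ → Fm C → Sub
  upd σ x ψ y with x ≟ y
  ... | yes _ = ψ
  ... | no _  = σ y

  above : List ℕ → ℕ
  above = foldr (λ v a → suc v ⊔ a) 0

  fresh : Sub → Fm C → ℕ
  fresh σ φ = foldr (λ u a → above (fv (σ u)) ⊔ a) 0 (fv φ)

  sub : Sub → Fm C → Fm C
  sub σ (var x)   = σ x
  sub σ tt        = tt
  sub σ ff        = ff
  sub σ (con c)   = con c
  sub σ (~ φ)     = ~ sub σ φ
  sub σ (□ φ)     = □ sub σ φ
  sub σ (φ ⇒ ψ)   = sub σ φ ⇒ sub σ ψ
  sub σ (φ ∨' ψ)  = sub σ φ ∨' sub σ ψ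
  sub σ (φ ∧' ψ)  = sub σ φ ∧' sub σ ψ
  sub σ (φ ≡≡ ψ)  = sub σ φ ≡≡ sub σ ψ
  sub σ (∀' x φ)  = ∀' y (sub (upd σ x (var y)) φ)
    where y = fresh σ (∀' x φ)

  _[_≔_] : Fm C → ℕ → Fm C → Fm C
  φ [ x ≔ ψ ] = sub (upd var x ψ) φ

  -- α-equivalence: equality after replacing bound variables by
  -- de Bruijn indices.

  data DB : Set where
    fr   : ℕ → DB
    bd   : ℕ → DB
    tt   : DB
    ff   : DB
    con  : C → DB
    neg  : DB → DB
    box  : DB → DB
    imp  : DB → DB → DB
    or   : DB → DB → DB
    and  : DB → DB → DB
    ident : DB → DB → DB
    all  : DB → DB

  lookupVar : List ℕ → ℕ → ℕ → DB
  lookupVar [] i x = fr x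
  lookupVar (y ∷ ys) i x with x ≟ y
  ... | yes _ = bd i
  ... | no _  = lookupVar ys (suc i) x

  toDB : List ℕ → Fm C → DB
  toDB env (var x)   = lookupVar env 0 x
  toDB env tt        = tt
  toDB env ff        = ff
  toDB env (con c)   = con c
  toDB env (~ φ)     = neg (toDB env φ)
  toDB env (□ φ)     = box (toDB env φ)
  toDB env (φ ⇒ ψ)   = imp (toDB env φ) (toDB env ψ)
  toDB env (φ ∨' ψ)  = or (toDB env φ) (toDB env ψ)
  toDB env (φ ∧' ψ)  = and (toDB env φ) (toDB env ψ)
  toDB env (φ ≡≡ ψ)  = ident (toDB env φ) (toDB env ψ)
  toDB env (∀' x φ)  = all (toDB (x ∷ env) φ)

  _=α_ : Fm C → Fm C → Set
  φ =α ψ = toDB [] φ ≡ toDB [] ψ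

data PF : Set where
  atom : ℕ → PF
  ptt  : PF
  pff  : PF
  pneg : PF → PF
  pimp : PF → PF → PF
  por  : PF → PF → PF
  pand : PF → PF → PF

eval : (ℕ → Bool) → PF → Bool
eval v (atom n)   = v n
eval v ptt        = true
eval v pff        = false
eval v (pneg p)   = not (eval v p)
eval v (pimp p q) = not (eval v p) ∨ eval v q
eval v (por p q)  = eval v p ∨ eval v q
eval v (pand p q) = eval v p ∧ eval v q

Tautology : PF → Set
Tautology p = (v : ℕ → Bool) → eval v p ≡ true

instPF : {C : Set} → (ℕ → Fm C) → PF → Fm C
instPF τ (atom n)   = τ n
instPF τ ptt        = tt
instPF τ pff        = ff
instPF τ (pneg p)   = ~ instPF τ p
instPF τ (pimp p q) = instPF τ p ⇒ instPF τ q
instPF τ (por p q)  = instPF τ p ∨' instPF τ q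
instPF τ (pand p q) = instPF τ p ∧' instPF τ q

data Sys : Set where
  S3 S4 S5 : Sys

Has4 : Sys → Set
Has4 S3 = ⊥
Has4 S4 = ⊤
Has4 S5 = ⊤

Has5 : Sys → Set
Has5 S5 = ⊤
Has5 _  = ⊥

data AX {C : Set} (m : Sys) : Fm C → Set where
  ax-taut  : (p : PF) (τ : ℕ → Fm C) → Tautology p → AX m (instPF τ p)
  ax-T     : (φ : Fm C) → AX m (□ φ ⇒ φ)
  ax-K     : (φ ψ : Fm C) → AX m (□ (φ ⇒ ψ) ⇒ (□ φ ⇒ □ ψ))
  ax-S3    : (φ ψ : Fm C) → AX m (□ (φ ⇒ ψ) ⇒ □ (□ φ ⇒ □ ψ))
  ax-α     : (φ ψ : Fm C) → φ =α ψ → AX m (φ ≡≡ ψ)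
  ax-≡MP   : (φ ψ : Fm C) → AX m ((φ ≡≡ ψ) ⇒ (φ ⇒ ψ))
  ax-SI    : (φ ψ ψ' : Fm C) (x : ℕ) → x ∈ fv φ →
             AX m ((ψ ≡≡ ψ') ⇒ (φ [ x ≔ ψ ] ≡≡ φ [ x ≔ ψ' ]))
  ax-∀≡    : (x : ℕ) (φ ψ : Fm C) → AX m (∀' x (φ ≡≡ ψ) ⇒ (∀' x φ ≡≡ ∀' x ψ))
  ax-∀E    : (x : ℕ) (φ ψ : Fm C) → AX m (∀' x φ ⇒ φ [ x ≔ ψ ])
  ax-∀K    : (x : ℕ) (φ ψ : Fm C) → AX m (∀' x (φ ⇒ ψ) ⇒ (∀' x φ ⇒ ∀' x ψ))
  ax-∀vac  : (x : ℕ) (φ ψ : Fm C) → x ∉ fv φ → AX m (∀' x (φ ⇒ ψ) ⇒ (φ ⇒ ∀' x ψ))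
  ax-CBF   : (x : ℕ) (φ : Fm C) → AX m (□ ∀' x φ ⇒ ∀' x (□ φ))
  ax-BF    : (x : ℕ) (φ : Fm C) → AX m (∀' x (□ φ) ⇒ □ ∀' x φ)
  ax-4     : Has4 m → (φ : Fm C) → AX m (□ φ ⇒ □ □ φ)
  ax-5     : Has5 m → (φ : Fm C) → AX m (~ □ φ ⇒ □ ~ □ φ)
  ax-gen   : {φ : Fm C} (x : ℕ) → AX m φ → x ∈ fv φ → AX m (∀' x φ)

Axiom : {C : Set} → Sys → Fm C → Set
Axiom m φ = AX m φ × WF φ

data ⊢ {C : Set} (m : Sys) : Fm C → Set where
  ax  : {φ : Fm C} → Axiom m φ → ⊢ m φ
  mp  : {φ ψ : Fm C} → ⊢ m φ → ⊢ m (φ ⇒ ψ) → ⊢ m ψ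
  nec : {φ : Fm C} → Axiom m φ → ⊢ m (□ φ)

-- Substitutivity (axiom vii) applied to χ = □(φ ≡ x), with x fresh for φ, gives
-- (φ ≡ ψ) → (□(φ[x:=φ] ≡ φ) ≡ □(φ[x:=ψ] ≡ ψ)).  Substitution only renames bound
-- variables of φ, so both φ[x:=φ] and φ[x:=ψ] are α-equivalent to φ: the left side
-- is a necessitated α-axiom, and the right side turns into □(φ ≡ ψ) through the
-- α-axiom under □ and K.
module Submission where

open import Defs
open import Function using (_∘_; case_of_)
open import Data.Nat using (ℕ; suc; _⊔_; _<_; _≤_)
open import Data.Nat.Properties using (_≟_; m≤m⊔n; m≤n⊔m; ≤-trans; <-irrefl; <⇒≢)
open import Data.Bool using (true; false)
open import Data.List using (List; []; _∷_; _++_; foldr)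
open import Data.List.Membership.Propositional using (_∈_; _∉_)
open import Data.List.Membership.Propositional.Properties using (∈-++⁺ˡ; ∈-++⁺ʳ; ∈-++⁻)
open import Data.List.Relation.Unary.Any using (here; there)
open import Data.Product using (_×_; _,_; ∃)
open import Data.Sum using ([_,_]′)
open import Data.Unit using (tt)
open import Data.Empty using (⊥-elim)
open import Relation.Nullary using (yes; no)
open import Relation.Binary.PropositionalEquality hiding ([_])

≤-foldr-⊔ : (f : ℕ → ℕ) {u : ℕ} {l : List ℕ} → u ∈ l → f u ≤ foldr (λ v a → f v ⊔ a) 0 l
≤-foldr-⊔ f (here refl)  = m≤m⊔n _ _
≤-foldr-⊔ f (there u∈l) = ≤-trans (≤-foldr-⊔ f u∈l) (m≤n⊔m _ _)

∈-++-map : {u v : ℕ} (xs : List ℕ) {ys xs' ys' : List ℕ} →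
           (u ∈ xs → v ∈ xs') → (u ∈ ys → v ∈ ys') → u ∈ xs ++ ys → v ∈ xs' ++ ys'
∈-++-map xs {xs' = xs'} f g = [ ∈-++⁺ˡ ∘ f , ∈-++⁺ʳ xs' ∘ g ]′ ∘ ∈-++⁻ xs

module _ {C : Set} where

  ∈-remove⁺ : {u : ℕ} (x : ℕ) {l : List ℕ} → u ∈ l → u ≢ x → u ∈ remove {C} x l
  ∈-remove⁺ x {y ∷ _} (here refl) u≢x with x ≟ y
  ... | yes x≡u = ⊥-elim (u≢x (sym x≡u))
  ... | no _    = here refl
  ∈-remove⁺ x {y ∷ _} (there u∈l) u≢x with x ≟ y
  ... | yes _ = ∈-remove⁺ x u∈l u≢x
  ... | no _  = there (∈-remove⁺ x u∈l u≢x)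

  ∈-remove⁻ : {u : ℕ} (x : ℕ) (l : List ℕ) → u ∈ remove {C} x l → u ∈ l × u ≢ x
  ∈-remove⁻ x (y ∷ l) u∈ with x ≟ y
  ∈-remove⁻ x (y ∷ l) u∈          | yes _ with ∈-remove⁻ x l u∈
  ... | u∈l , u≢x = there u∈l , u≢x
  ∈-remove⁻ x (y ∷ l) (here refl)  | no x≢u = here refl , x≢u ∘ sym
  ∈-remove⁻ x (y ∷ l) (there u∈)   | no _ with ∈-remove⁻ x l u∈
  ... | u∈l , u≢x = there u∈l , u≢x

  <-above : {v : ℕ} {l : List ℕ} → v ∈ l → v < above {C} l
  <-above = ≤-foldr-⊔ suc

  above-∉ : (l : List ℕ) → above {C} l ∉ l
  above-∉ l a∈l = <-irrefl refl (<-above a∈l)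

  <-fresh : (σ : Sub {C}) (φ : Fm C) {u v : ℕ} → u ∈ fv φ → v ∈ fv (σ u) → v < fresh σ φ
  <-fresh σ φ u∈φ v∈σu = ≤-trans (<-above v∈σu) (≤-foldr-⊔ (λ u → above {C} (fv (σ u))) u∈φ)

  upd-same : (σ : Sub {C}) (x : ℕ) (θ : Fm C) → upd σ x θ x ≡ θ
  upd-same σ x θ with x ≟ x
  ... | yes _  = refl
  ... | no x≢x = ⊥-elim (x≢x refl)

  upd-diff : (σ : Sub {C}) (x : ℕ) (θ : Fm C) {u : ℕ} → u ≢ x → upd σ x θ u ≡ σ u
  upd-diff σ x θ {u} u≢x with x ≟ u
  ... | yes x≡u = ⊥-elim (u≢x (sym x≡u))
  ... | no _    = refl

  WF-upd : {σ : Sub {C}} {θ : Fm C} (x : ℕ) → (∀ u → WF (σ u)) → WF θ → ∀ u → WF (upd σ x θ u)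
  WF-upd x wσ wθ u with x ≟ u
  ... | yes _ = wθ
  ... | no _  = wσ u

  ∈-fv-sub : (φ : Fm C) (σ : Sub) {u v : ℕ} → v ∈ fv (σ u) → u ∈ fv φ → v ∈ fv (sub σ φ)
  ∈-fv-sub (var x)  σ v∈σu (here refl) = v∈σu
  ∈-fv-sub (~ φ)    σ v∈σu = ∈-fv-sub φ σ v∈σu
  ∈-fv-sub (□ φ)    σ v∈σu = ∈-fv-sub φ σ v∈σu
  ∈-fv-sub (φ ⇒ ψ)  σ v∈σu = ∈-++-map (fv φ) (∈-fv-sub φ σ v∈σu) (∈-fv-sub ψ σ v∈σu)
  ∈-fv-sub (φ ∨' ψ) σ v∈σu = ∈-++-map (fv φ) (∈-fv-sub φ σ v∈σu) (∈-fv-sub ψ σ v∈σu)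
  ∈-fv-sub (φ ∧' ψ) σ v∈σu = ∈-++-map (fv φ) (∈-fv-sub φ σ v∈σu) (∈-fv-sub ψ σ v∈σu)
  ∈-fv-sub (φ ≡≡ ψ) σ v∈σu = ∈-++-map (fv φ) (∈-fv-sub φ σ v∈σu) (∈-fv-sub ψ σ v∈σu)
  ∈-fv-sub (∀' x φ) σ {u} {v} v∈σu u∈∀ with ∈-remove⁻ x (fv φ) u∈∀
  ... | u∈φ , u≢x = ∈-remove⁺ y (∈-fv-sub φ (upd σ x (var y)) v∈σ'u u∈φ) v≢y
    where
      y = fresh σ (∀' x φ)
      v∈σ'u : v ∈ fv (upd σ x (var y) u)
      v∈σ'u = subst (λ t → v ∈ fv t) (sym (upd-diff σ x (var y) u≢x)) v∈σu
      v≢y : v ≢ y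
      v≢y = <⇒≢ (<-fresh σ (∀' x φ) u∈∀ v∈σu)

  WF-sub : (φ : Fm C) (σ : Sub) → (∀ u → WF (σ u)) → WF φ → WF (sub σ φ)
  WF-sub (var x)  σ wσ _ = wσ x
  WF-sub tt       σ wσ _ = tt
  WF-sub ff       σ wσ _ = tt
  WF-sub (con c)  σ wσ _ = tt
  WF-sub (~ φ)    σ wσ wφ = WF-sub φ σ wσ wφ
  WF-sub (□ φ)    σ wσ wφ = WF-sub φ σ wσ wφ
  WF-sub (φ ⇒ ψ)  σ wσ (wφ , wψ) = WF-sub φ σ wσ wφ , WF-sub ψ σ wσ wψ
  WF-sub (φ ∨' ψ) σ wσ (wφ , wψ) = WF-sub φ σ wσ wφ , WF-sub ψ σ wσ wψ
  WF-sub (φ ∧' ψ) σ wσ (wφ , wψ) = WF-sub φ σ wσ wφ , WF-sub ψ σ wσ wψ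
  WF-sub (φ ≡≡ ψ) σ wσ (wφ , wψ) = WF-sub φ σ wσ wφ , WF-sub ψ σ wσ wψ
  WF-sub (∀' x φ) σ wσ (x∈φ , wφ) =
    ∈-fv-sub φ σ' (subst (λ t → y ∈ fv t) (sym (upd-same σ x (var y))) (here refl)) x∈φ ,
    WF-sub φ σ' (WF-upd x wσ tt) wφ
    where
      y  = fresh σ (∀' x φ)
      σ' = upd σ x (var y)

  WF-[≔] : (φ : Fm C) (x : ℕ) (θ : Fm C) → WF φ → WF θ → WF (φ [ x ≔ θ ])
  WF-[≔] φ x θ wφ wθ = WF-sub φ _ (WF-upd x (λ _ → tt) wθ) wφ

  shift : DB {C} → DB {C}
  shift (bd i) = bd (suc i)
  shift d      = d

  lookupVar-suc : (e : List ℕ) (i v : ℕ) → lookupVar {C} e (suc i) v ≡ shift (lookupVar e i v)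
  lookupVar-suc []      i v = refl
  lookupVar-suc (y ∷ e) i v with v ≟ y
  ... | yes _ = refl
  ... | no _  = lookupVar-suc e (suc i) v

  lookupVar-∷-same : (e : List ℕ) (y : ℕ) → lookupVar {C} (y ∷ e) 0 y ≡ bd 0
  lookupVar-∷-same e y with y ≟ y
  ... | yes _  = refl
  ... | no y≢y = ⊥-elim (y≢y refl)

  lookupVar-∷-diff : (e : List ℕ) {y v : ℕ} → v ≢ y → lookupVar {C} (y ∷ e) 0 v ≡ shift (lookupVar e 0 v)
  lookupVar-∷-diff e {y} {v} v≢y with v ≟ y
  ... | yes v≡y = ⊥-elim (v≢y v≡y)
  ... | no _    = lookupVar-suc e 0 v

  Renames : List ℕ → List ℕ → Sub {C} → List ℕ → Set
  Renames e₁ e₂ σ xs =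
    ∀ {u} → u ∈ xs → ∃ λ v → σ u ≡ var v × lookupVar {C} e₁ 0 v ≡ lookupVar e₂ 0 u

  Renames-under-∀ : (σ : Sub) (x : ℕ) (φ : Fm C) {e₁ e₂ : List ℕ} →
                    Renames e₁ e₂ σ (fv (∀' x φ)) →
                    Renames (fresh σ (∀' x φ) ∷ e₁) (x ∷ e₂) (upd σ x (var (fresh σ (∀' x φ)))) (fv φ)
  Renames-under-∀ σ x φ {e₁} {e₂} ρ {u} u∈φ = case u ≟ x of λ where
      (yes refl) → y , upd-same σ x (var y) , trans (lookupVar-∷-same e₁ y) (sym (lookupVar-∷-same e₂ x))
      (no u≢x)   → renamed u≢x (ρ (∈-remove⁺ x u∈φ u≢x))
    where
      open ≡-Reasoning
      y = fresh σ (∀' x φ)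
      renamed : u ≢ x → ∃ (λ v → σ u ≡ var v × lookupVar {C} e₁ 0 v ≡ lookupVar e₂ 0 u) →
                ∃ (λ v → upd σ x (var y) u ≡ var v × lookupVar {C} (y ∷ e₁) 0 v ≡ lookupVar (x ∷ e₂) 0 u)
      renamed u≢x (v , σu≡v , same) = v , trans (upd-diff σ x _ u≢x) σu≡v , (begin
        lookupVar (y ∷ e₁) 0 v   ≡⟨ lookupVar-∷-diff e₁ v≢y ⟩
        shift (lookupVar e₁ 0 v) ≡⟨ cong shift same ⟩
        shift (lookupVar e₂ 0 u) ≡⟨ sym (lookupVar-∷-diff e₂ u≢x) ⟩
        lookupVar (x ∷ e₂) 0 u   ∎)
        where
          v≢y : v ≢ y
          v≢y = <⇒≢ (<-fresh σ (∀' x φ) (∈-remove⁺ x u∈φ u≢x)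
                       (subst (λ t → v ∈ fv t) (sym σu≡v) (here refl)))

  toDB-sub-renaming : (φ : Fm C) (σ : Sub) {e₁ e₂ : List ℕ} →
                      Renames e₁ e₂ σ (fv φ) → toDB e₁ (sub σ φ) ≡ toDB e₂ φ
  toDB-sub-renaming (var x) σ ρ with ρ (here refl)
  ... | v , σx≡v , same rewrite σx≡v = same
  toDB-sub-renaming tt       σ ρ = refl
  toDB-sub-renaming ff       σ ρ = refl
  toDB-sub-renaming (con c)  σ ρ = refl
  toDB-sub-renaming (~ φ)    σ ρ = cong neg (toDB-sub-renaming φ σ ρ)
  toDB-sub-renaming (□ φ)    σ ρ = cong box (toDB-sub-renaming φ σ ρ)
  toDB-sub-renaming (φ ⇒ ψ)  σ ρ =
    cong₂ imp (toDB-sub-renaming φ σ (ρ ∘ ∈-++⁺ˡ)) (toDB-sub-renaming ψ σ (ρ ∘ ∈-++⁺ʳ (fv φ)))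
  toDB-sub-renaming (φ ∨' ψ) σ ρ =
    cong₂ or (toDB-sub-renaming φ σ (ρ ∘ ∈-++⁺ˡ)) (toDB-sub-renaming ψ σ (ρ ∘ ∈-++⁺ʳ (fv φ)))
  toDB-sub-renaming (φ ∧' ψ) σ ρ =
    cong₂ and (toDB-sub-renaming φ σ (ρ ∘ ∈-++⁺ˡ)) (toDB-sub-renaming ψ σ (ρ ∘ ∈-++⁺ʳ (fv φ)))
  toDB-sub-renaming (φ ≡≡ ψ) σ ρ =
    cong₂ ident (toDB-sub-renaming φ σ (ρ ∘ ∈-++⁺ˡ)) (toDB-sub-renaming ψ σ (ρ ∘ ∈-++⁺ʳ (fv φ)))
  toDB-sub-renaming (∀' x φ) σ ρ = cong all (toDB-sub-renaming φ _ (Renames-under-∀ σ x φ ρ))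

  sub-id-α : (φ : Fm C) (σ : Sub) → (∀ {u} → u ∈ fv φ → σ u ≡ var u) → sub σ φ =α φ
  sub-id-α φ σ σ≗var = toDB-sub-renaming φ σ (λ {u} u∈φ → u , σ≗var u∈φ , refl)

  [≔]-fresh-α : (φ : Fm C) {x : ℕ} (θ : Fm C) → x ∉ fv φ → (φ [ x ≔ θ ]) =α φ
  [≔]-fresh-α φ {x} θ x∉φ =
    sub-id-α φ _ (λ u∈φ → upd-diff var x θ (λ u≡x → x∉φ (subst (_∈ fv φ) u≡x u∈φ)))

⇒-trans-PF : PF
⇒-trans-PF = pimp (pimp (atom 0) (atom 1)) (pimp (pimp (atom 1) (atom 2)) (pimp (atom 0) (atom 2)))

⇒-trans-taut : Tautology ⇒-trans-PF
⇒-trans-taut v with v 0 | v 1 | v 2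
... | true  | true  | true  = refl
... | true  | true  | false = refl
... | true  | false | true  = refl
... | true  | false | false = refl
... | false | true  | true  = refl
... | false | true  | false = refl
... | false | false | true  = refl
... | false | false | false = refl

⇒-cut-PF : PF
⇒-cut-PF = pimp (atom 0) (pimp (pimp (atom 1) (pimp (atom 0) (atom 2))) (pimp (atom 1) (atom 2)))

⇒-cut-taut : Tautology ⇒-cut-PF
⇒-cut-taut v with v 0 | v 1 | v 2
... | true  | true  | true  = refl
... | true  | true  | false = refl
... | true  | false | true  = refl
... | true  | false | false = refl
... | false | true  | true  = refl
... | false | true  | false = refl
... | false | false | true  = refl
... | false | false | false = refl

module _ {C : Set} {m : Sys} where

  atoms₃ : Fm C → Fm C → Fm C → ℕ → Fm C
  atoms₃ a b c 0 = a
  atoms₃ a b c 1 = b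
  atoms₃ a b c _ = c

  ⇒-trans : {a b c : Fm C} → WF a → WF b → WF c → ⊢ m (a ⇒ b) → ⊢ m (b ⇒ c) → ⊢ m (a ⇒ c)
  ⇒-trans {a} {b} {c} wa wb wc ⊢a⇒b ⊢b⇒c =
    mp ⊢b⇒c (mp ⊢a⇒b (ax (ax-taut ⇒-trans-PF (atoms₃ a b c) ⇒-trans-taut ,
                            (wa , wb) , (wb , wc) , (wa , wc))))

  ⇒-cut : {a b c : Fm C} → WF a → WF b → WF c → ⊢ m a → ⊢ m (b ⇒ (a ⇒ c)) → ⊢ m (b ⇒ c)
  ⇒-cut {a} {b} {c} wa wb wc ⊢a ⊢b⇒a⇒c =
    mp ⊢b⇒a⇒c (mp ⊢a (ax (ax-taut ⇒-cut-PF (atoms₃ a b c) ⇒-cut-taut ,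
                           wa , (wb , wa , wc) , (wb , wc))))

  ≡-elim : {a b p : Fm C} → WF a → WF b → WF p → ⊢ m (p ⇒ (a ≡≡ b)) → ⊢ m a → ⊢ m (p ⇒ b)
  ≡-elim {a} {b} wa wb wp ⊢p⇒a≡b ⊢a =
    ⇒-cut wa wp wb ⊢a (⇒-trans wp (wa , wb) (wa , wb) ⊢p⇒a≡b
                         (ax (ax-≡MP a b , (wa , wb) , (wa , wb))))

  □-distrib : {a b : Fm C} → WF a → WF b → ⊢ m (□ (a ⇒ b)) → ⊢ m (□ a ⇒ □ b)
  □-distrib {a} {b} wa wb ⊢□a⇒b = mp ⊢□a⇒b (ax (ax-K a b , (wa , wb) , (wa , wb)))

  □-α : {a b : Fm C} → WF a → WF b → a =α b → ⊢ m (□ a ⇒ □ b)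
  □-α {a} {b} wa wb a=αb =
    □-distrib wa wb (mp (nec (ax-α a b a=αb , wa , wb))
                        (□-distrib (wa , wb) (wa , wb) (nec (ax-≡MP a b , (wa , wb) , (wa , wb)))))

lemma6 : {C : Set} (m : Sys) (φ ψ : Fm C) → WF φ → WF ψ →
    ⊢ m ((φ ≡≡ ψ) ⇒ □ (φ ≡≡ ψ))
lemma6 {C} m φ ψ wφ wψ = ⇒-trans wP (wφψ , wψ) wP ⊢P⇒□φψ≡ψ (□-α (wφψ , wψ) wP φψ≡ψ=αP)
  where
    x : ℕ
    x = above {C} (fv φ)
    x∉φ : x ∉ fv φ
    x∉φ = above-∉ {C} (fv φ)
    χ : Fm C
    χ = □ (φ ≡≡ var x)
    P : Fm C
    P = φ ≡≡ ψ
    wP : WF P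
    wP = wφ , wψ
    wφφ : WF (φ [ x ≔ φ ])
    wφφ = WF-[≔] φ x φ wφ wφ
    wφψ : WF (φ [ x ≔ ψ ])
    wφψ = WF-[≔] φ x ψ wφ wψ
    χ-at : (θ : Fm C) → χ [ x ≔ θ ] ≡ □ (φ [ x ≔ θ ] ≡≡ θ)
    χ-at θ = cong (λ t → □ (φ [ x ≔ θ ] ≡≡ t)) (upd-same var x θ)
    SI : ⊢ m (P ⇒ (□ (φ [ x ≔ φ ] ≡≡ φ) ≡≡ □ (φ [ x ≔ ψ ] ≡≡ ψ)))
    SI = ax (subst₂ (λ s t → AX m (P ⇒ (s ≡≡ t))) (χ-at φ) (χ-at ψ)
               (ax-SI χ φ ψ x (∈-++⁺ʳ (fv φ) (here refl))) ,
             wP , (wφφ , wφ) , (wφψ , wψ))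
    ⊢φφ≡φ : ⊢ m (□ (φ [ x ≔ φ ] ≡≡ φ))
    ⊢φφ≡φ = nec (ax-α (φ [ x ≔ φ ]) φ ([≔]-fresh-α φ φ x∉φ) , wφφ , wφ)
    ⊢P⇒□φψ≡ψ : ⊢ m (P ⇒ □ (φ [ x ≔ ψ ] ≡≡ ψ))
    ⊢P⇒□φψ≡ψ = ≡-elim (wφφ , wφ) (wφψ , wψ) wP SI ⊢φφ≡φ
    φψ≡ψ=αP : (φ [ x ≔ ψ ] ≡≡ ψ) =α P
    φψ≡ψ=αP = cong₂ ident ([≔]-fresh-α φ ψ x∉φ) refl
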